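{- Let $\varepsilon\in\{ -1,1\}$, and let $L=(k+3)\sigma^2-\varepsilon(2k+3)(1+2z)\sigma+k$. For $z\in\mathbb{Z}$ let $F_k(z)$ denote either $\varepsilon^kS_k(z)$ for all $k$, or $\varepsilon^k s_k(z)$ for all $k$. Then for any $n,z\in\mathbb{Z}$ with $n>1$ and any polynomial $y(k)\in\mathbb{Z}[k]$, \[ \sum_{k=0}^{n-1}L^{\ast}\big(y(k)(k+1)(k+2)\big)F_k(z)\equiv 0\pmod{n(n^2-1)}. \]
   Context: $\sigma$ is the shift operator, $\sigma F(k)=F(k+1)$. For $L=\sum_{i=0}^{2}a_i(k)\sigma^i$ with $a_2(k)=k+3$, $a_1(k)=-\varepsilon(2k+3)(1+2z)$, $a_0(k)=k$, the adjoint is $L^*(x(k))=\sum_{i=0}^{2}a_i(k-i)x(k-i)$. The large Schröder polynomials are $S_n(z)=\sum_{j=0}^{n}\binom{n}{j}\binom{n+j}{j}\frac{1}{j+1}z^j$ ($n\ge0$); the little Schröder polynomials are $s_0(z)=0$ and $s_n(z)=\sum_{j=1}^{n}\frac{1}{n}\binom{n}{j}\binom{n}{j-1}z^{j-1}(z+1)^{n-j}$ ($n\ge1$). -}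

module Defs where

open import Data.Nat using (ℕ; zero; suc) renaming (_+_ to _+ℕ_; _*_ to _*ℕ_; _/_ to _/ℕ_)
open import Data.Nat.Combinatorics using (_C_)
open import Data.Integer using (ℤ; +_; _+_; _-_; _*_; -_; _^_)
open import Data.List using (List; []; _∷_)

sumBelow : ℕ → (ℕ → ℤ) → ℤ
sumBelow zero    f = + 0
sumBelow (suc n) f = sumBelow n f + f n

sumFromTo : ℕ → ℕ → (ℕ → ℤ) → ℤ
sumFromTo a b f = sumBelow (suc b Data.Nat.∸ a) (λ i → f (a +ℕ i))
  where import Data.Nat

-- A polynomial in ℤ[k], given by its coefficient list [c0, c1, c2, …]
-- (c0 + c1 k + c2 k^2 + …), evaluated by Horner's rule.
evalPoly : List ℤ → ℤ → ℤ
evalPoly []       k = + 0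
evalPoly (c ∷ cs) k = c + k * evalPoly cs k

-- Coefficients of L = a2(k) σ^2 + a1(k) σ + a0(k), depending on ε and z.
a0 : ℤ → ℤ → ℤ → ℤ
a0 ε z k = k

a1 : ℤ → ℤ → ℤ → ℤ
a1 ε z k = - (ε * ((+ 2 * k + + 3) * (+ 1 + + 2 * z)))

a2 : ℤ → ℤ → ℤ → ℤ
a2 ε z k = k + + 3

Ladj : ℤ → ℤ → (ℤ → ℤ) → ℤ → ℤ
Ladj ε z x k =
  a0 ε z k * x k + a1 ε z (k - + 1) * x (k - + 1) + a2 ε z (k - + 2) * x (k - + 2)

-- Large Schröder polynomials: S_n(z) = Σ_{j=0}^{n} C(n,j) C(n+j,j) / (j+1) z^j.
-- (The quotient C(n,j)C(n+j,j)/(j+1) = C(n+j,2j)·Catalan(j) is an exact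
-- division in ℕ.)
largeSchroder : ℕ → ℤ → ℤ
largeSchroder n z =
  sumFromTo 0 n (λ j → + (((n C j) *ℕ ((n +ℕ j) C j)) /ℕ (suc j)) * z ^ j)

-- Little Schröder polynomials: s_0 = 0,
-- s_n(z) = Σ_{j=1}^{n} (1/n) C(n,j) C(n,j-1) z^(j-1) (z+1)^(n-j)  (n ≥ 1).
-- (The quotient C(n,j)C(n,j-1)/n is a Narayana number: exact division in ℕ.)
littleSchroder : ℕ → ℤ → ℤ
littleSchroder zero    z = + 0
littleSchroder (suc m) z =
  sumFromTo 1 (suc m) (λ j →
    + (((suc m C j) *ℕ (suc m C (j Data.Nat.∸ 1))) /ℕ (suc m))
      * (z ^ (j Data.Nat.∸ 1)) * ((z + + 1) ^ (suc m Data.Nat.∸ j)))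
  where import Data.Nat

-- Both Fₖ = εᵏ Sₖ(z) and Fₖ = εᵏ sₖ(z) solve L F = 0: the Schröder polynomials satisfy
-- (k+3) P_{k+2} − (2k+3)(1+2z) P_{k+1} + k Pₖ = 0, and ε² = 1 absorbs the sign twist.
-- For a solution F, summation by parts collapses Σ_{k<n} L*(x)(k) Fₖ to the boundary term
-- (n−1) x(n−1) F_{n−1} − (n+1) x(n−2) Fₙ, because x(k) = y(k)(k+1)(k+2) vanishes at k = −1, −2;
-- with this x the boundary term is (n−1) n (n+1) (y(n−1) F_{n−1} − y(n−2) Fₙ).
-- The recurrences are checked coefficientwise, Sₖ in the basis zʲ and s_{k+1} in the basis
-- zⁱ (z+1)^{k−i}. Both coefficient families are hypergeometric in two indices, so every coefficient
-- in a recurrence is an explicit rational multiple of one of them, and over a common denominator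
-- the coefficient identity becomes a polynomial identity.

module Submission where

open import Defs
open import Data.Nat using (ℕ; _≤_)
open import Data.Integer using (ℤ; +_; _+_; _*_; _-_; -_; _^_; 1ℤ; -1ℤ)
open import Data.Integer.Divisibility using (_∣_)
open import Data.List using (List)
open import Data.Sum using (_⊎_)
open import Relation.Binary.PropositionalEquality using (_≡_)

open import Data.Nat as ℕ using (zero; suc)
import Data.Nat.Properties as ℕ
import Data.Nat.Divisibility as ℕ
open import Data.Nat.Combinatorics using (_C_; nCk+nC[k+1]≡[n+1]C[k+1]; nC1≡n; k>n⇒nCk≡0)
open import Data.Nat.DivMod using (m*[n/m]≡n)
open import Data.Integer using (0ℤ; ∣_∣)
open import Data.Integer.Properties
  using (pos-+; pos-*; abs-*; *-cancelˡ-≡; *-zeroˡ; *-zeroʳ; *-identityˡ; *-identityʳ; *-assoc; *-distribˡ-+;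
         +-identityˡ; +-identityʳ; +-assoc)
open import Data.Integer.Tactic.RingSolver using (solve-∀; solve)
open import Data.List using ([]; _∷_; foldr)
open import Data.List.Relation.Unary.All as All using (All)
open import Data.Product using (_×_; _,_)
open import Data.Sum using (inj₁; inj₂)
open import Relation.Binary.PropositionalEquality
open ≡-Reasoning

binom : ℕ → ℕ → ℤ
binom n k = + (n C k)

binom-pascal : ∀ n k → binom (suc n) (suc k) ≡ binom n k + binom n (suc k)
binom-pascal n k = trans (cong +_ (sym (nCk+nC[k+1]≡[n+1]C[k+1] n k))) (pos-+ (n C k) (n C suc k))

binom-absorb : ∀ n k → + suc k * binom (suc n) (suc k) ≡ + suc n * binom n k
binom-absorb zero    zero    = refl
binom-absorb zero    (suc k) = *-zeroʳ (+ suc (suc k))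
binom-absorb (suc n) zero    =
  trans (*-identityˡ _) (trans (cong +_ (nC1≡n (suc (suc n)))) (sym (*-identityʳ (+ suc (suc n)))))
binom-absorb (suc n) (suc k) = begin
  + suc (suc k) * binom (suc (suc n)) (suc (suc k))
    ≡⟨ cong (+ suc (suc k) *_) (binom-pascal (suc n) (suc k)) ⟩
  + suc (suc k) * (x + y)
    ≡⟨ regroup (+ k) x y ⟩
  + suc k * x + x + + suc (suc k) * y
    ≡⟨ cong₂ (λ u v → u + x + v) (binom-absorb n k) (binom-absorb n (suc k)) ⟩
  + suc n * binom n k + x + + suc n * binom n (suc k)
    ≡⟨ regroup′ (+ n) (binom n k) x (binom n (suc k)) ⟩
  + suc n * (binom n k + binom n (suc k)) + x
    ≡⟨ cong (λ u → + suc n * u + x) (sym (binom-pascal n k)) ⟩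
  + suc n * x + x
    ≡⟨ regroup″ (+ n) x ⟩
  + suc (suc n) * x ∎
  where
  x y : ℤ
  x = binom (suc n) (suc k)
  y = binom (suc n) (suc (suc k))
  regroup : ∀ K x y → (+ 2 + K) * (x + y) ≡ (+ 1 + K) * x + x + (+ 2 + K) * y
  regroup = solve-∀
  regroup′ : ∀ N u x v → (+ 1 + N) * u + x + (+ 1 + N) * v ≡ (+ 1 + N) * (u + v) + x
  regroup′ = solve-∀
  regroup″ : ∀ N x → (+ 1 + N) * x + x ≡ (+ 2 + N) * x
  regroup″ = solve-∀

binom-shiftᵏ : ∀ n k → + suc k * binom n (suc k) ≡ (+ n - + k) * binom n k
binom-shiftᵏ n k = begin
  + suc k * binom n (suc k)                                   ≡⟨ split (+ k) (binom n k) (binom n (suc k)) ⟩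
  + suc k * (binom n k + binom n (suc k)) - + suc k * binom n k ≡⟨ cong (λ u → + suc k * u - + suc k * binom n k) (sym (binom-pascal n k)) ⟩
  + suc k * binom (suc n) (suc k) - + suc k * binom n k       ≡⟨ cong (_- + suc k * binom n k) (binom-absorb n k) ⟩
  + suc n * binom n k - + suc k * binom n k                   ≡⟨ factor (+ n) (+ k) (binom n k) ⟩
  (+ n - + k) * binom n k                                     ∎
  where
  split : ∀ K u v → (+ 1 + K) * v ≡ (+ 1 + K) * (u + v) - (+ 1 + K) * u
  split = solve-∀
  factor : ∀ N K u → (+ 1 + N) * u - (+ 1 + K) * u ≡ (N - K) * u
  factor = solve-∀

binom-shiftⁿ : ∀ n k → (+ suc n - + k) * binom (suc n) k ≡ + suc n * binom n k
binom-shiftⁿ n k = trans (sym (binom-shiftᵏ (suc n) k)) (binom-absorb n k)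

*-zero-cancelˡ : ∀ n {x} → + suc n * x ≡ 0ℤ → x ≡ 0ℤ
*-zero-cancelˡ n {x} eq = *-cancelˡ-≡ (+ suc n) x 0ℤ (trans eq (sym (*-zeroʳ (+ suc n))))

-- A record rather than the bare equation d * x ≡ p * y, so that unification recovers d, p, x, y
-- (multiplication on ℤ is not injective).
record Ratio (d p x y : ℤ) : Set where
  constructor ratio
  field cross : d * x ≡ p * y

ratio-trans : ∀ {d₁ p₁ d₂ p₂ x y w : ℤ} → Ratio d₁ p₁ x y → Ratio d₂ p₂ y w → Ratio (d₁ * d₂) (p₁ * p₂) x w
ratio-trans {d₁} {p₁} {d₂} {p₂} {x} {y} {w} (ratio h₁) (ratio h₂) = ratio (begin
  (d₁ * d₂) * x   ≡⟨ solve (d₁ ∷ d₂ ∷ x ∷ []) ⟩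
  d₂ * (d₁ * x)   ≡⟨ cong (d₂ *_) h₁ ⟩
  d₂ * (p₁ * y)   ≡⟨ solve (d₂ ∷ p₁ ∷ y ∷ []) ⟩
  p₁ * (d₂ * y)   ≡⟨ cong (p₁ *_) h₂ ⟩
  p₁ * (p₂ * w)   ≡⟨ solve (p₁ ∷ p₂ ∷ w ∷ []) ⟩
  (p₁ * p₂) * w   ∎)

ratio-rescale : ∀ {d p x y D P : ℤ} e → Ratio d p x y → D ≡ e * d → P ≡ e * p → Ratio D P x y
ratio-rescale {d} {p} {x} {y} e (ratio h) refl refl = ratio (begin
  (e * d) * x   ≡⟨ solve (e ∷ d ∷ x ∷ []) ⟩
  e * (d * x)   ≡⟨ cong (e *_) h ⟩
  e * (p * y)   ≡⟨ solve (e ∷ p ∷ y ∷ []) ⟩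
  (e * p) * y   ∎)

Σ⟨_⟩ : ∀ {A : Set} → (A → ℤ) → List A → ℤ
Σ⟨ f ⟩ = foldr (λ t r → f t + r) 0ℤ

HasNumerator : ℤ → ℤ → ℤ → ℤ × ℤ × ℤ → Set
HasNumerator D g b (a , x , Q) = Ratio D (g * Q) x b

common-denominator : ∀ {D g b : ℤ} (ts : List (ℤ × ℤ × ℤ)) → All (HasNumerator D g b) ts →
  D * Σ⟨ (λ (a , x , Q) → a * x) ⟩ ts ≡ g * Σ⟨ (λ (a , x , Q) → a * Q) ⟩ ts * b
common-denominator {D} {g} {b} []                 All.[]               = solve (D ∷ g ∷ b ∷ [])
common-denominator {D} {g} {b} ((a , x , Q) ∷ ts) (ratio h All.∷ hs) = begin
  D * (a * x + Σx)                 ≡⟨ distrib D a x Σx ⟩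
  a * (D * x) + D * Σx             ≡⟨ cong₂ (λ u v → a * u + v) h (common-denominator {D} {g} {b} ts hs) ⟩
  a * (g * Q * b) + g * ΣQ * b     ≡⟨ collect a g Q b ΣQ ⟩
  g * (a * Q + ΣQ) * b             ∎
  where
  Σx ΣQ : ℤ
  Σx = Σ⟨ (λ (a , x , Q) → a * x) ⟩ ts
  ΣQ = Σ⟨ (λ (a , x , Q) → a * Q) ⟩ ts
  distrib : ∀ D a x s → D * (a * x + s) ≡ a * (D * x) + D * s
  distrib = solve-∀
  collect : ∀ a g Q b s → a * (g * Q * b) + g * s * b ≡ g * (a * Q + s) * b
  collect = solve-∀

*-quotient-exact : ∀ d N (w : ℤ) → + suc d * w ≡ + N → + suc d * + (N ℕ./ suc d) ≡ + N
*-quotient-exact d N w eq = trans (sym (pos-* (suc d) _)) (cong +_ (m*[n/m]≡n (ℕ.divides ∣ w ∣ N≡∣w∣*[d+1])))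
  where
  N≡∣w∣*[d+1] : N ≡ ∣ w ∣ ℕ.* suc d
  N≡∣w∣*[d+1] = trans (cong ∣_∣ (sym eq)) (trans (abs-* (+ suc d) w) (ℕ.*-comm (suc d) ∣ w ∣))

m∣m*n : ∀ m n → m ∣ m * n
m∣m*n m n = subst (∣ m ∣ ℕ.∣_) (sym (abs-* m n)) (ℕ.m∣m*n ∣ n ∣)

sumBelow-cong< : ∀ N {f g : ℕ → ℤ} → (∀ i → i ℕ.< N → f i ≡ g i) → sumBelow N f ≡ sumBelow N g
sumBelow-cong< zero    eq = refl
sumBelow-cong< (suc N) eq =
  cong₂ _+_ (sumBelow-cong< N (λ i i<N → eq i (ℕ.m<n⇒m<1+n i<N))) (eq N ℕ.≤-refl)

sumBelow-cong : ∀ N {f g : ℕ → ℤ} → (∀ i → f i ≡ g i) → sumBelow N f ≡ sumBelow N g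
sumBelow-cong N eq = sumBelow-cong< N (λ i _ → eq i)

sumBelow-+ : ∀ N (f g : ℕ → ℤ) → sumBelow N (λ i → f i + g i) ≡ sumBelow N f + sumBelow N g
sumBelow-+ zero    f g = refl
sumBelow-+ (suc N) f g = trans (cong (_+ (f N + g N)) (sumBelow-+ N f g)) (interchange (sumBelow N f) (sumBelow N g) (f N) (g N))
  where interchange : ∀ a b c d → a + b + (c + d) ≡ a + c + (b + d)
        interchange = solve-∀

sumBelow-*ˡ : ∀ N α (f : ℕ → ℤ) → sumBelow N (λ i → α * f i) ≡ α * sumBelow N f
sumBelow-*ˡ zero    α f = sym (*-zeroʳ α)
sumBelow-*ˡ (suc N) α f = trans (cong (_+ α * f N) (sumBelow-*ˡ N α f)) (sym (*-distribˡ-+ α _ (f N)))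

sumBelow-zero : ∀ N {f : ℕ → ℤ} → (∀ i → f i ≡ 0ℤ) → sumBelow N f ≡ 0ℤ
sumBelow-zero zero    eq = refl
sumBelow-zero (suc N) eq = cong₂ _+_ (sumBelow-zero N eq) (eq N)

sumBelow-head : ∀ N (f : ℕ → ℤ) → sumBelow (suc N) f ≡ f 0 + sumBelow N (λ i → f (suc i))
sumBelow-head zero    f = trans (+-identityˡ (f 0)) (sym (+-identityʳ (f 0)))
sumBelow-head (suc N) f = trans (cong (_+ f (suc N)) (sumBelow-head N f)) (+-assoc (f 0) _ _)

sumBelow-last-zero : ∀ N (f : ℕ → ℤ) → f N ≡ 0ℤ → sumBelow (suc N) f ≡ sumBelow N f
sumBelow-last-zero N f fN≡0 = trans (cong (λ t → sumBelow N f + t) fN≡0) (+-identityʳ _)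

weighted : ℕ → (ℕ → ℤ) → (ℕ → ℤ) → ℤ
weighted N a w = sumBelow N (λ i → a i * w i)

shift : (ℕ → ℤ) → ℕ → ℤ
shift a zero    = 0ℤ
shift a (suc i) = a i

weighted-shift : ∀ N a w → weighted (suc N) (shift a) w ≡ weighted N a (λ i → w (suc i))
weighted-shift N a w = trans (sumBelow-head N _) (+-identityˡ _)

weighted-extend : ∀ N a w → a N ≡ 0ℤ → weighted (suc N) a w ≡ weighted N a w
weighted-extend N a w aN≡0 = sumBelow-last-zero N _ (trans (cong (_* w N) aN≡0) (*-zeroˡ (w N)))

weighted-*ʷ : ∀ N a w t → t * weighted N a w ≡ weighted N a (λ i → t * w i)
weighted-*ʷ N a w t = trans (sym (sumBelow-*ˡ N t _)) (sumBelow-cong N (λ i → reorder t (a i) (w i)))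
  where reorder : ∀ t a w → t * (a * w) ≡ a * (t * w)
        reorder = solve-∀

LinComb : Set
LinComb = List (ℤ × (ℕ → ℤ))

lincomb : LinComb → ((ℕ → ℤ) → ℤ) → ℤ
lincomb []             ev = 0ℤ
lincomb ((α , a) ∷ ts) ev = α * ev a + lincomb ts ev

weighted-lincomb : ∀ N w ts → weighted N (λ i → lincomb ts (λ a → a i)) w ≡ lincomb ts (λ a → weighted N a w)
weighted-lincomb N w []             = sumBelow-zero N (λ i → *-zeroˡ (w i))
weighted-lincomb N w ((α , a) ∷ ts) = begin
  sumBelow N (λ i → (α * a i + rest i) * w i)          ≡⟨ sumBelow-cong N (λ i → distrib α (a i) (rest i) (w i)) ⟩
  sumBelow N (λ i → α * (a i * w i) + rest i * w i)    ≡⟨ sumBelow-+ N _ _ ⟩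
  sumBelow N (λ i → α * (a i * w i)) + weighted N rest w ≡⟨ cong₂ _+_ (sumBelow-*ˡ N α _) (weighted-lincomb N w ts) ⟩
  α * weighted N a w + lincomb ts (λ b → weighted N b w) ∎
  where
  rest : ℕ → ℤ
  rest i = lincomb ts (λ b → b i)
  distrib : ∀ α a r w → (α * a + r) * w ≡ α * (a * w) + r * w
  distrib = solve-∀

SchröderRecurrence : (ℕ → ℤ → ℤ) → Set
SchröderRecurrence P = ∀ k z →
  (+ k + + 3) * P (suc (suc k)) z - (+ 2 * + k + + 3) * (1ℤ + + 2 * z) * P (suc k) z + + k * P k z ≡ 0ℤ

largeCoeff : ℕ → ℕ → ℤ
largeCoeff n j = + (((n C j) ℕ.* ((n ℕ.+ j) C j)) ℕ./ suc j)

-- The exact quotient is C(n+1,j+1) C(n+j,j) − C(n,j) C(n+j,j+1).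
largeCoeff-spec : ∀ n j → + suc j * largeCoeff n j ≡ binom n j * binom (n ℕ.+ j) j
largeCoeff-spec n j = trans (*-quotient-exact j _ _ (begin
  + suc j * (binom (suc n) (suc j) * binom (n ℕ.+ j) j - binom n j * binom (n ℕ.+ j) (suc j))
    ≡⟨ distribute (+ j) (binom (suc n) (suc j)) (binom (n ℕ.+ j) j) (binom n j) (binom (n ℕ.+ j) (suc j)) ⟩
  + suc j * binom (suc n) (suc j) * binom (n ℕ.+ j) j - binom n j * (+ suc j * binom (n ℕ.+ j) (suc j))
    ≡⟨ cong₂ (λ u v → u * binom (n ℕ.+ j) j - binom n j * v) (binom-absorb n j) (binom-shiftᵏ (n ℕ.+ j) j) ⟩
  + suc n * binom n j * binom (n ℕ.+ j) j - binom n j * ((+ n + + j - + j) * binom (n ℕ.+ j) j)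
    ≡⟨ collapse (+ n) (+ j) (binom n j) (binom (n ℕ.+ j) j) ⟩
  binom n j * binom (n ℕ.+ j) j
    ≡⟨ pos-* (n C j) _ ⟨
  + ((n C j) ℕ.* ((n ℕ.+ j) C j)) ∎)) (pos-* (n C j) _)
  where
  distribute : ∀ J a b c d → (+ 1 + J) * (a * b - c * d) ≡ (+ 1 + J) * a * b - c * ((+ 1 + J) * d)
  distribute = solve-∀
  collapse : ∀ N J u v → (+ 1 + N) * u * v - u * ((N + J - J) * v) ≡ u * v
  collapse = solve-∀

-- Factors are written + 1 + I, + 2 + K + I, … so that at I = + i, K = + k they are definitionally
-- the + suc i, + suc (suc (k ℕ.+ i)), … produced by the ℕ-indexed lemmas.
largeCoeff-shiftʲ : ∀ n i → + suc i * + suc (suc i) * largeCoeff n (suc i) ≡ + suc (n ℕ.+ i) * (+ n - + i) * largeCoeff n i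
largeCoeff-shiftʲ n i = *-cancelˡ-≡ (+ suc i) _ _
  (core (+ n) (+ i) (largeCoeff n i) (largeCoeff n (suc i)) _ _ _ _
        (largeCoeff-spec n i) (largeCoeff-spec n (suc i)) (binom-shiftᵏ n i) absorb)
  where
  absorb : + suc i * binom (n ℕ.+ suc i) (suc i) ≡ + suc (n ℕ.+ i) * binom (n ℕ.+ i) i
  absorb = trans (cong (λ m → + suc i * binom m (suc i)) (ℕ.+-suc n i)) (binom-absorb (n ℕ.+ i) i)
  core : ∀ N I c₀ c₁ x₀ y₀ x₁ y₁ →
         (+ 1 + I) * c₀ ≡ x₀ * y₀ → (+ 2 + I) * c₁ ≡ x₁ * y₁ →
         (+ 1 + I) * x₁ ≡ (N - I) * x₀ → (+ 1 + I) * y₁ ≡ (+ 1 + N + I) * y₀ →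
         (+ 1 + I) * ((+ 1 + I) * (+ 2 + I) * c₁) ≡ (+ 1 + I) * ((+ 1 + N + I) * (N - I) * c₀)
  core N I c₀ c₁ x₀ y₀ x₁ y₁ spec₀ spec₁ ratioˣ ratioʸ = begin
    (+ 1 + I) * ((+ 1 + I) * (+ 2 + I) * c₁)   ≡⟨ solve (I ∷ c₁ ∷ []) ⟩
    (+ 1 + I) * (+ 1 + I) * ((+ 2 + I) * c₁)   ≡⟨ cong ((+ 1 + I) * (+ 1 + I) *_) spec₁ ⟩
    (+ 1 + I) * (+ 1 + I) * (x₁ * y₁)          ≡⟨ solve (I ∷ x₁ ∷ y₁ ∷ []) ⟩
    ((+ 1 + I) * x₁) * ((+ 1 + I) * y₁)        ≡⟨ cong₂ _*_ ratioˣ ratioʸ ⟩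
    ((N - I) * x₀) * ((+ 1 + N + I) * y₀)      ≡⟨ solve (N ∷ I ∷ x₀ ∷ y₀ ∷ []) ⟩
    (+ 1 + N + I) * (N - I) * (x₀ * y₀)        ≡⟨ cong ((+ 1 + N + I) * (N - I) *_) spec₀ ⟨
    (+ 1 + N + I) * (N - I) * ((+ 1 + I) * c₀) ≡⟨ solve (N ∷ I ∷ c₀ ∷ []) ⟩
    (+ 1 + I) * ((+ 1 + N + I) * (N - I) * c₀) ∎

largeCoeff-shiftⁿ : ∀ n j → + suc (n ℕ.+ j) * largeCoeff n j ≡ (+ suc n - + j) * largeCoeff (suc n) j
largeCoeff-shiftⁿ n j = sym (*-cancelˡ-≡ (+ suc n) _ _ (*-cancelˡ-≡ (+ suc j) _ _
  (core (+ n) (+ j) (largeCoeff n j) (largeCoeff (suc n) j) _ _ _ _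
        (largeCoeff-spec n j) (largeCoeff-spec (suc n) j) (binom-shiftⁿ n j) (binom-shiftⁿ (n ℕ.+ j) j))))
  where
  core : ∀ N J c₀ c₁ x₀ y₀ x₁ y₁ →
         (+ 1 + J) * c₀ ≡ x₀ * y₀ → (+ 1 + J) * c₁ ≡ x₁ * y₁ →
         (+ 1 + N - J) * x₁ ≡ (+ 1 + N) * x₀ → (+ 1 + N + J - J) * y₁ ≡ (+ 1 + N + J) * y₀ →
         (+ 1 + J) * ((+ 1 + N) * ((+ 1 + N - J) * c₁)) ≡ (+ 1 + J) * ((+ 1 + N) * ((+ 1 + N + J) * c₀))
  core N J c₀ c₁ x₀ y₀ x₁ y₁ spec₀ spec₁ ratioˣ ratioʸ = begin
    (+ 1 + J) * ((+ 1 + N) * ((+ 1 + N - J) * c₁))          ≡⟨ solve (N ∷ J ∷ c₁ ∷ []) ⟩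
    (+ 1 + N - J) * (+ 1 + N + J - J) * ((+ 1 + J) * c₁)    ≡⟨ cong ((+ 1 + N - J) * (+ 1 + N + J - J) *_) spec₁ ⟩
    (+ 1 + N - J) * (+ 1 + N + J - J) * (x₁ * y₁)           ≡⟨ solve (N ∷ J ∷ x₁ ∷ y₁ ∷ []) ⟩
    ((+ 1 + N - J) * x₁) * ((+ 1 + N + J - J) * y₁)         ≡⟨ cong₂ _*_ ratioˣ ratioʸ ⟩
    ((+ 1 + N) * x₀) * ((+ 1 + N + J) * y₀)                 ≡⟨ solve (N ∷ J ∷ x₀ ∷ y₀ ∷ []) ⟩
    (+ 1 + N) * (+ 1 + N + J) * (x₀ * y₀)                   ≡⟨ cong ((+ 1 + N) * (+ 1 + N + J) *_) spec₀ ⟨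
    (+ 1 + N) * (+ 1 + N + J) * ((+ 1 + J) * c₀)            ≡⟨ solve (N ∷ J ∷ c₀ ∷ []) ⟩
    (+ 1 + J) * ((+ 1 + N) * ((+ 1 + N + J) * c₀))          ∎

-- Row and column steps express the four coefficients c(k+2,i+1), c(k+1,i+1), c(k+1,i), c(k,i+1)
-- as rational multiples of b = c(k+2,i).
largeCoeff-recurrence-algebra : ∀ K I b Y X₁ X₂ X₃ →
  Ratio ((+ 1 + I) * (+ 2 + I)) ((+ 3 + K + I) * (+ 2 + K - I)) X₁ b →
  Ratio (+ 2 + K + I) (+ 2 + K - I) Y b →
  Ratio ((+ 1 + I) * (+ 2 + I)) ((+ 2 + K + I) * (+ 1 + K - I)) X₂ Y →
  Ratio (+ 1 + (K + (+ 1 + I))) (+ 1 + K - (+ 1 + I)) X₃ X₂ →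
  (+ 1 + I) * ((+ 2 + I) * ((+ 2 + K + I) * ((+ 2 + K + I) *
    ((K + + 3) * X₁ - (+ 2 * K + + 3) * X₂ - + 2 * (+ 2 * K + + 3) * Y + K * X₃)))) ≡ 0ℤ
largeCoeff-recurrence-algebra K I b Y X₁ X₂ X₃ col₂ row₁ col₁ row₀ = begin
  (+ 1 + I) * ((+ 2 + I) * ((+ 2 + K + I) * ((+ 2 + K + I) *
    ((K + + 3) * X₁ - (+ 2 * K + + 3) * X₂ - + 2 * (+ 2 * K + + 3) * Y + K * X₃))))
    ≡⟨ solve (K ∷ I ∷ X₁ ∷ X₂ ∷ X₃ ∷ Y ∷ []) ⟩
  (+ 1 + I) * (+ 2 + I) * (+ 2 + K + I) * (+ 2 + K + I) *
    ((K + + 3) * X₁ + (- (+ 2 * K + + 3) * X₂ + (- (+ 2 * (+ 2 * K + + 3)) * Y + (K * X₃ + 0ℤ))))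
    ≡⟨ common-denominator {(+ 1 + I) * (+ 2 + I) * (+ 2 + K + I) * (+ 2 + K + I)} {(+ 2 + K + I) * (+ 2 + K - I)} {b}
         ( (K + + 3                  , X₁ , (+ 2 + K + I) * (+ 3 + K + I))
         ∷ (- (+ 2 * K + + 3)        , X₂ , (+ 2 + K + I) * (+ 1 + K - I))
         ∷ (- (+ 2 * (+ 2 * K + + 3)) , Y  , (+ 1 + I) * (+ 2 + I))
         ∷ (K                        , X₃ , (K - I) * (+ 1 + K - I))
         ∷ [])
         ( ratio-rescale ((+ 2 + K + I) * (+ 2 + K + I)) col₂ (solve (K ∷ I ∷ [])) (solve (K ∷ I ∷ []))
         All.∷ ratio-rescale (+ 2 + K + I) (ratio-trans col₁ row₁) (solve (K ∷ I ∷ [])) (solve (K ∷ I ∷ []))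
         All.∷ ratio-rescale ((+ 1 + I) * (+ 2 + I) * (+ 2 + K + I)) row₁ (solve (K ∷ I ∷ [])) (solve (K ∷ I ∷ []))
         All.∷ ratio-rescale (+ 1) (ratio-trans row₀ (ratio-trans col₁ row₁)) (solve (K ∷ I ∷ [])) (solve (K ∷ I ∷ []))
         All.∷ All.[]) ⟩
  (+ 2 + K + I) * (+ 2 + K - I) *
    ((K + + 3) * ((+ 2 + K + I) * (+ 3 + K + I))
    + (- (+ 2 * K + + 3) * ((+ 2 + K + I) * (+ 1 + K - I))
    + (- (+ 2 * (+ 2 * K + + 3)) * ((+ 1 + I) * (+ 2 + I))
    + (K * ((K - I) * (+ 1 + K - I)) + 0ℤ)))) * b
    ≡⟨ solve (K ∷ I ∷ b ∷ []) ⟩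
  0ℤ ∎

largeCoeff-recurrence : ∀ k j →
  (+ k + + 3) * largeCoeff (suc (suc k)) j - (+ 2 * + k + + 3) * largeCoeff (suc k) j
    - + 2 * (+ 2 * + k + + 3) * shift (largeCoeff (suc k)) j + + k * largeCoeff k j ≡ 0ℤ
largeCoeff-recurrence k zero    = base (+ k)
  where base : ∀ K → (K + + 3) * 1ℤ - (+ 2 * K + + 3) * 1ℤ - + 2 * (+ 2 * K + + 3) * 0ℤ + K * 1ℤ ≡ 0ℤ
        base = solve-∀
largeCoeff-recurrence k (suc i) =
  *-zero-cancelˡ (suc (k ℕ.+ i)) (*-zero-cancelˡ (suc (k ℕ.+ i)) (*-zero-cancelˡ (suc i) (*-zero-cancelˡ i
    (largeCoeff-recurrence-algebra (+ k) (+ i) _ _ _ _ _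
      (ratio (largeCoeff-shiftʲ (suc (suc k)) i)) (ratio (largeCoeff-shiftⁿ (suc k) i))
      (ratio (largeCoeff-shiftʲ (suc k) i)) (ratio (largeCoeff-shiftⁿ k (suc i)))))))

largeCoeff-vanishes : ∀ n j → n ℕ.< j → largeCoeff n j ≡ 0ℤ
largeCoeff-vanishes n j n<j rewrite k>n⇒nCk≡0 n<j = refl

largeSchroder-recurrence : SchröderRecurrence largeSchroder
largeSchroder-recurrence k z = combine S₂ S₁ S₀ (W c₁) (W (shift c₁)) (W c₀) S₁≡ zS₁≡ S₀≡
  (trans (sym (weighted-lincomb N w terms)) (sumBelow-zero N pointwise))
  where
  N : ℕ
  N = suc (suc (suc k))
  w : ℕ → ℤ
  w i = z ^ i
  W : (ℕ → ℤ) → ℤ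
  W a = weighted N a w
  c₀ c₁ c₂ : ℕ → ℤ
  c₀ = largeCoeff k
  c₁ = largeCoeff (suc k)
  c₂ = largeCoeff (suc (suc k))
  S₀ S₁ S₂ : ℤ
  S₀ = largeSchroder k z
  S₁ = largeSchroder (suc k) z
  S₂ = largeSchroder (suc (suc k)) z
  terms : LinComb
  terms = (+ k + + 3 , c₂) ∷ (- (+ 2 * + k + + 3) , c₁) ∷ (- (+ 2 * (+ 2 * + k + + 3)) , shift c₁) ∷ (+ k , c₀) ∷ []
  pointwise : ∀ i → lincomb terms (λ a → a i) * w i ≡ 0ℤ
  pointwise i = trans (cong (_* w i) (trans (regroup (+ k) (c₂ i) (c₁ i) (shift c₁ i) (c₀ i)) (largeCoeff-recurrence k i)))
                      (*-zeroˡ (w i))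
    where regroup : ∀ K a b c d → (K + + 3) * a + (- (+ 2 * K + + 3) * b + (- (+ 2 * (+ 2 * K + + 3)) * c + (K * d + 0ℤ)))
                                ≡ (K + + 3) * a - (+ 2 * K + + 3) * b - + 2 * (+ 2 * K + + 3) * c + K * d
          regroup = solve-∀
  S₁≡ : S₁ ≡ W c₁
  S₁≡ = sym (weighted-extend (suc (suc k)) c₁ w (largeCoeff-vanishes (suc k) (suc (suc k)) ℕ.≤-refl))
  zS₁≡ : z * S₁ ≡ W (shift c₁)
  zS₁≡ = trans (weighted-*ʷ (suc (suc k)) c₁ w z) (sym (weighted-shift (suc (suc k)) c₁ w))
  S₀≡ : S₀ ≡ W c₀
  S₀≡ = sym (trans (weighted-extend (suc (suc k)) c₀ w (largeCoeff-vanishes k (suc (suc k)) (ℕ.m<n⇒m<1+n (ℕ.n<1+n k))))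
                   (weighted-extend (suc k) c₀ w (largeCoeff-vanishes k (suc k) ℕ.≤-refl)))
  combine : ∀ S₂ S₁ S₀ T₁ T₁′ T₀ → S₁ ≡ T₁ → z * S₁ ≡ T₁′ → S₀ ≡ T₀ →
            (+ k + + 3) * S₂ + (- (+ 2 * + k + + 3) * T₁ + (- (+ 2 * (+ 2 * + k + + 3)) * T₁′ + (+ k * T₀ + 0ℤ))) ≡ 0ℤ →
            (+ k + + 3) * S₂ - (+ 2 * + k + + 3) * (1ℤ + + 2 * z) * S₁ + + k * S₀ ≡ 0ℤ
  combine S₂ S₁ S₀ _ _ _ refl refl refl = trans (regroup (+ k) z S₂ S₁ S₀)
    where regroup : ∀ K z S₂ S₁ S₀ → (K + + 3) * S₂ - (+ 2 * K + + 3) * (1ℤ + + 2 * z) * S₁ + K * S₀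
                                   ≡ (K + + 3) * S₂ + (- (+ 2 * K + + 3) * S₁ + (- (+ 2 * (+ 2 * K + + 3)) * (z * S₁) + (K * S₀ + 0ℤ)))
          regroup = solve-∀

-- The coefficient of zⁱ (z+1)^{m−i} in s_{m+1}, i.e. the Narayana number N(m+1, i+1).
littleCoeff : ℕ → ℕ → ℤ
littleCoeff m i = + (((suc m C suc i) ℕ.* (suc m C i)) ℕ./ suc m)

-- The exact quotient is C(m,i) C(m+1,i+1) − C(m+1,i) C(m,i+1).
littleCoeff-spec : ∀ m i → + suc m * littleCoeff m i ≡ binom (suc m) (suc i) * binom (suc m) i
littleCoeff-spec m i = trans (*-quotient-exact m _ _ (begin
  + suc m * (binom m i * B₁ - B₀ * binom m (suc i))
    ≡⟨ distribute (+ m) (binom m i) B₁ B₀ (binom m (suc i)) ⟩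
  B₁ * (+ suc m * binom m i) - B₀ * (+ suc m * binom m (suc i))
    ≡⟨ cong₂ (λ u v → B₁ * u - B₀ * v) (binom-shiftⁿ m i) (binom-shiftⁿ m (suc i)) ⟨
  B₁ * ((+ suc m - + i) * B₀) - B₀ * ((+ suc m - + suc i) * B₁)
    ≡⟨ collapse (+ m) (+ i) B₀ B₁ ⟩
  B₁ * B₀
    ≡⟨ pos-* (suc m C suc i) (suc m C i) ⟨
  + ((suc m C suc i) ℕ.* (suc m C i)) ∎)) (pos-* (suc m C suc i) (suc m C i))
  where
  B₀ B₁ : ℤ
  B₀ = binom (suc m) i
  B₁ = binom (suc m) (suc i)
  distribute : ∀ M a b c d → (+ 1 + M) * (a * b - c * d) ≡ b * ((+ 1 + M) * a) - c * ((+ 1 + M) * d)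
  distribute = solve-∀
  collapse : ∀ M I B₀ B₁ → B₁ * ((+ 1 + M - I) * B₀) - B₀ * ((+ 1 + M - (+ 1 + I)) * B₁) ≡ B₁ * B₀
  collapse = solve-∀

littleCoeff-shiftⁱ : ∀ m i → + suc i * + suc (suc i) * littleCoeff m (suc i) ≡ (+ m - + i) * (+ suc m - + i) * littleCoeff m i
littleCoeff-shiftⁱ m i = *-cancelˡ-≡ (+ suc m) _ _
  (core (+ m) (+ i) (littleCoeff m i) (littleCoeff m (suc i)) (binom (suc m) i) (binom (suc m) (suc i)) (binom (suc m) (suc (suc i)))
        (littleCoeff-spec m i) (littleCoeff-spec m (suc i)) (binom-shiftᵏ (suc m) i) (binom-shiftᵏ (suc m) (suc i)))
  where
  core : ∀ M I c₀ c₁ B₀ B₁ B₂ →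
         (+ 1 + M) * c₀ ≡ B₁ * B₀ → (+ 1 + M) * c₁ ≡ B₂ * B₁ →
         (+ 1 + I) * B₁ ≡ (+ 1 + M - I) * B₀ → (+ 2 + I) * B₂ ≡ (+ 1 + M - (+ 1 + I)) * B₁ →
         (+ 1 + M) * ((+ 1 + I) * (+ 2 + I) * c₁) ≡ (+ 1 + M) * ((M - I) * (+ 1 + M - I) * c₀)
  core M I c₀ c₁ B₀ B₁ B₂ spec₀ spec₁ ratio₀ ratio₁ = begin
    (+ 1 + M) * ((+ 1 + I) * (+ 2 + I) * c₁)     ≡⟨ solve (M ∷ I ∷ c₁ ∷ []) ⟩
    (+ 1 + I) * (+ 2 + I) * ((+ 1 + M) * c₁)     ≡⟨ cong ((+ 1 + I) * (+ 2 + I) *_) spec₁ ⟩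
    (+ 1 + I) * (+ 2 + I) * (B₂ * B₁)            ≡⟨ solve (I ∷ B₁ ∷ B₂ ∷ []) ⟩
    ((+ 2 + I) * B₂) * ((+ 1 + I) * B₁)          ≡⟨ cong₂ _*_ ratio₁ ratio₀ ⟩
    ((+ 1 + M - (+ 1 + I)) * B₁) * ((+ 1 + M - I) * B₀) ≡⟨ solve (M ∷ I ∷ B₀ ∷ B₁ ∷ []) ⟩
    (M - I) * (+ 1 + M - I) * (B₁ * B₀)          ≡⟨ cong ((M - I) * (+ 1 + M - I) *_) spec₀ ⟨
    (M - I) * (+ 1 + M - I) * ((+ 1 + M) * c₀)   ≡⟨ solve (M ∷ I ∷ c₀ ∷ []) ⟩
    (+ 1 + M) * ((M - I) * (+ 1 + M - I) * c₀)   ∎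

littleCoeff-shiftᵐ : ∀ m i → + suc m * + suc (suc m) * littleCoeff m i ≡ (+ suc m - + i) * (+ suc (suc m) - + i) * littleCoeff (suc m) i
littleCoeff-shiftᵐ m i = *-cancelˡ-≡ (+ suc (suc m)) _ _
  (core (+ m) (+ i) (littleCoeff m i) (littleCoeff (suc m) i)
              (binom (suc m) i) (binom (suc m) (suc i)) (binom (suc (suc m)) i) (binom (suc (suc m)) (suc i))
        (littleCoeff-spec m i) (littleCoeff-spec (suc m) i) (binom-shiftⁿ (suc m) (suc i)) (binom-shiftⁿ (suc m) i))
  where
  core : ∀ M I c₀ c₁ B₀ B₁ B₀′ B₁′ →
         (+ 1 + M) * c₀ ≡ B₁ * B₀ → (+ 2 + M) * c₁ ≡ B₁′ * B₀′ →
         (+ 2 + M - (+ 1 + I)) * B₁′ ≡ (+ 2 + M) * B₁ → (+ 2 + M - I) * B₀′ ≡ (+ 2 + M) * B₀ →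
         (+ 2 + M) * ((+ 1 + M) * (+ 2 + M) * c₀) ≡ (+ 2 + M) * ((+ 1 + M - I) * (+ 2 + M - I) * c₁)
  core M I c₀ c₁ B₀ B₁ B₀′ B₁′ spec₀ spec₁ ratio₁ ratio₀ = begin
    (+ 2 + M) * ((+ 1 + M) * (+ 2 + M) * c₀)           ≡⟨ solve (M ∷ c₀ ∷ []) ⟩
    (+ 2 + M) * (+ 2 + M) * ((+ 1 + M) * c₀)           ≡⟨ cong ((+ 2 + M) * (+ 2 + M) *_) spec₀ ⟩
    (+ 2 + M) * (+ 2 + M) * (B₁ * B₀)                  ≡⟨ solve (M ∷ B₀ ∷ B₁ ∷ []) ⟩
    ((+ 2 + M) * B₁) * ((+ 2 + M) * B₀)                ≡⟨ cong₂ _*_ ratio₁ ratio₀ ⟨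
    ((+ 2 + M - (+ 1 + I)) * B₁′) * ((+ 2 + M - I) * B₀′) ≡⟨ solve (M ∷ I ∷ B₀′ ∷ B₁′ ∷ []) ⟩
    (+ 1 + M - I) * (+ 2 + M - I) * (B₁′ * B₀′)        ≡⟨ cong ((+ 1 + M - I) * (+ 2 + M - I) *_) spec₁ ⟨
    (+ 1 + M - I) * (+ 2 + M - I) * ((+ 2 + M) * c₁)   ≡⟨ solve (M ∷ I ∷ c₁ ∷ []) ⟩
    (+ 2 + M) * ((+ 1 + M - I) * (+ 2 + M - I) * c₁)   ∎

littleCoeff-zero : ∀ m → littleCoeff m 0 ≡ 1ℤ
littleCoeff-zero m = *-cancelˡ-≡ (+ suc m) _ _ (begin
  + suc m * littleCoeff m 0             ≡⟨ littleCoeff-spec m 0 ⟩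
  binom (suc m) 1 * 1ℤ                  ≡⟨ *-identityʳ _ ⟩
  binom (suc m) 1                       ≡⟨ cong +_ (nC1≡n (suc m)) ⟩
  + suc m                               ≡⟨ *-identityʳ (+ suc m) ⟨
  + suc m * 1ℤ                          ∎)

-- As for largeCoeff, with the six coefficients in rows m, m+1, m+2 and columns l, l+1, l+2
-- expressed through b = ν(m+2,l).
littleCoeff-recurrence-algebra : ∀ M L b p X₀₀ X₀₁ X₀₂ X₁₁ X₁₂ X₂₁ X₂₂ →
  Ratio ((+ 1 + L) * (+ 2 + L)) ((+ 2 + M - L) * (+ 3 + M - L)) X₂₁ b →
  Ratio ((+ 2 + L) * (+ 3 + L)) ((+ 2 + M - (+ 1 + L)) * (+ 3 + M - (+ 1 + L))) X₂₂ X₂₁ →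
  Ratio ((+ 1 + L) * (+ 2 + L)) ((+ 1 + M - L) * (+ 2 + M - L)) X₁₁ p →
  Ratio ((+ 2 + L) * (+ 3 + L)) ((+ 1 + M - (+ 1 + L)) * (+ 2 + M - (+ 1 + L))) X₁₂ X₁₁ →
  Ratio ((+ 1 + L) * (+ 2 + L)) ((M - L) * (+ 1 + M - L)) X₀₁ X₀₀ →
  Ratio ((+ 2 + L) * (+ 3 + L)) ((M - (+ 1 + L)) * (+ 1 + M - (+ 1 + L))) X₀₂ X₀₁ →
  Ratio ((+ 2 + M) * (+ 3 + M)) ((+ 2 + M - L) * (+ 3 + M - L)) p b →
  Ratio ((+ 1 + M) * (+ 2 + M)) ((+ 1 + M - L) * (+ 2 + M - L)) X₀₀ p →
  (+ 1 + M) * ((+ 2 + M) * ((+ 2 + M) * ((+ 3 + M) * ((+ 1 + L) * ((+ 2 + L) * ((+ 2 + L) * ((+ 3 + L) *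
    ((M + + 4) * X₂₂ - (+ 2 * M + + 5) * (X₁₂ + X₁₁) + (M + 1ℤ) * (X₀₂ - + 2 * X₀₁ + X₀₀))))))))) ≡ 0ℤ
littleCoeff-recurrence-algebra M L b p X₀₀ X₀₁ X₀₂ X₁₁ X₁₂ X₂₁ X₂₂ col₂₁ col₂₂ col₁₁ col₁₂ col₀₁ col₀₂ row₁ row₀ = begin
  (+ 1 + M) * ((+ 2 + M) * ((+ 2 + M) * ((+ 3 + M) * ((+ 1 + L) * ((+ 2 + L) * ((+ 2 + L) * ((+ 3 + L) *
    ((M + + 4) * X₂₂ - (+ 2 * M + + 5) * (X₁₂ + X₁₁) + (M + 1ℤ) * (X₀₂ - + 2 * X₀₁ + X₀₀)))))))))
    ≡⟨ solve (M ∷ L ∷ X₀₀ ∷ X₀₁ ∷ X₀₂ ∷ X₁₁ ∷ X₁₂ ∷ X₂₂ ∷ []) ⟩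
  (+ 1 + M) * (+ 2 + M) * (+ 2 + M) * (+ 3 + M) * ((+ 1 + L) * (+ 2 + L) * (+ 2 + L) * (+ 3 + L)) *
    ((M + + 4) * X₂₂ + (- (+ 2 * M + + 5) * X₁₂ + (- (+ 2 * M + + 5) * X₁₁
      + ((M + 1ℤ) * X₀₂ + (- (+ 2 * (M + 1ℤ)) * X₀₁ + ((M + 1ℤ) * X₀₀ + 0ℤ))))))
    ≡⟨ common-denominator {(+ 1 + M) * (+ 2 + M) * (+ 2 + M) * (+ 3 + M) * ((+ 1 + L) * (+ 2 + L) * (+ 2 + L) * (+ 3 + L))}
                          {(+ 1 + M - L) * (+ 2 + M - L) * (+ 2 + M - L) * (+ 3 + M - L)} {b}
         ( (M + + 4            , X₂₂ , (+ 1 + M) * (+ 2 + M) * (+ 2 + M) * (+ 3 + M))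
         ∷ (- (+ 2 * M + + 5)  , X₁₂ , (+ 1 + M) * (+ 2 + M) * (M - L) * (+ 1 + M - L))
         ∷ (- (+ 2 * M + + 5)  , X₁₁ , (+ 1 + M) * (+ 2 + M) * (+ 2 + L) * (+ 3 + L))
         ∷ (M + 1ℤ             , X₀₂ , (M - L) * (M - L) * (M - (+ 1 + L)) * (+ 1 + M - L))
         ∷ (- (+ 2 * (M + 1ℤ)) , X₀₁ , (+ 2 + L) * (+ 3 + L) * (M - L) * (+ 1 + M - L))
         ∷ (M + 1ℤ             , X₀₀ , (+ 1 + L) * (+ 2 + L) * (+ 2 + L) * (+ 3 + L))
         ∷ [])
         ( ratio-rescale ((+ 1 + M) * (+ 2 + M) * (+ 2 + M) * (+ 3 + M)) (ratio-trans col₂₂ col₂₁)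
                         (solve (M ∷ L ∷ [])) (solve (M ∷ L ∷ []))
         All.∷ ratio-rescale ((+ 1 + M) * (+ 2 + M)) (ratio-trans col₁₂ (ratio-trans col₁₁ row₁))
                             (solve (M ∷ L ∷ [])) (solve (M ∷ L ∷ []))
         All.∷ ratio-rescale ((+ 1 + M) * (+ 2 + M) * (+ 2 + L) * (+ 3 + L)) (ratio-trans col₁₁ row₁)
                             (solve (M ∷ L ∷ [])) (solve (M ∷ L ∷ []))
         All.∷ ratio-rescale (+ 1) (ratio-trans col₀₂ (ratio-trans col₀₁ (ratio-trans row₀ row₁)))
                             (solve (M ∷ L ∷ [])) (solve (M ∷ L ∷ []))
         All.∷ ratio-rescale ((+ 2 + L) * (+ 3 + L)) (ratio-trans col₀₁ (ratio-trans row₀ row₁))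
                             (solve (M ∷ L ∷ [])) (solve (M ∷ L ∷ []))
         All.∷ ratio-rescale ((+ 1 + L) * (+ 2 + L) * (+ 2 + L) * (+ 3 + L)) (ratio-trans row₀ row₁)
                             (solve (M ∷ L ∷ [])) (solve (M ∷ L ∷ []))
         All.∷ All.[]) ⟩
  (+ 1 + M - L) * (+ 2 + M - L) * (+ 2 + M - L) * (+ 3 + M - L) *
    ((M + + 4) * ((+ 1 + M) * (+ 2 + M) * (+ 2 + M) * (+ 3 + M))
    + (- (+ 2 * M + + 5) * ((+ 1 + M) * (+ 2 + M) * (M - L) * (+ 1 + M - L))
    + (- (+ 2 * M + + 5) * ((+ 1 + M) * (+ 2 + M) * (+ 2 + L) * (+ 3 + L))
    + ((M + 1ℤ) * ((M - L) * (M - L) * (M - (+ 1 + L)) * (+ 1 + M - L))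
    + (- (+ 2 * (M + 1ℤ)) * ((+ 2 + L) * (+ 3 + L) * (M - L) * (+ 1 + M - L))
    + ((M + 1ℤ) * ((+ 1 + L) * (+ 2 + L) * (+ 2 + L) * (+ 3 + L)) + 0ℤ)))))) * b
    ≡⟨ solve (M ∷ L ∷ b ∷ []) ⟩
  0ℤ ∎

littleCoeff-one : ∀ n → + 1 * + 2 * littleCoeff n 1 ≡ + n * + suc n
littleCoeff-one n = begin
  + 1 * + 2 * littleCoeff n 1                    ≡⟨ littleCoeff-shiftⁱ n 0 ⟩
  (+ n - + 0) * (+ suc n - + 0) * littleCoeff n 0 ≡⟨ cong ((+ n - + 0) * (+ suc n - + 0) *_) (littleCoeff-zero n) ⟩
  (+ n - + 0) * (+ suc n - + 0) * 1ℤ             ≡⟨ simplify (+ n) ⟩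
  + n * + suc n                                  ∎
  where simplify : ∀ N → (N - + 0) * (+ 1 + N - + 0) * 1ℤ ≡ N * (+ 1 + N)
        simplify = solve-∀

littleCoeff-recurrence-one-algebra : ∀ M y₀ y₁ y₂ u₀ u₁ → u₀ ≡ 1ℤ → u₁ ≡ 1ℤ →
  + 1 * + 2 * y₂ ≡ (+ 2 + M) * (+ 3 + M) → + 1 * + 2 * y₁ ≡ (+ 1 + M) * (+ 2 + M) → + 1 * + 2 * y₀ ≡ M * (+ 1 + M) →
  + 2 * ((M + + 4) * y₂ - (+ 2 * M + + 5) * (y₁ + u₁) + (M + 1ℤ) * (y₀ - + 2 * u₀ + 0ℤ)) ≡ 0ℤ
littleCoeff-recurrence-one-algebra M y₀ y₁ y₂ _ _ refl refl h₂ h₁ h₀ = begin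
  + 2 * ((M + + 4) * y₂ - (+ 2 * M + + 5) * (y₁ + 1ℤ) + (M + 1ℤ) * (y₀ - + 2 * 1ℤ + 0ℤ))
    ≡⟨ solve (M ∷ y₀ ∷ y₁ ∷ y₂ ∷ []) ⟩
  (M + + 4) * (+ 1 * + 2 * y₂) - (+ 2 * M + + 5) * (+ 1 * + 2 * y₁ + + 2) + (M + 1ℤ) * (+ 1 * + 2 * y₀ - + 4)
    ≡⟨ cong₂ (λ u v → (M + + 4) * u - (+ 2 * M + + 5) * (v + + 2) + (M + 1ℤ) * (+ 1 * + 2 * y₀ - + 4)) h₂ h₁ ⟩
  (M + + 4) * ((+ 2 + M) * (+ 3 + M)) - (+ 2 * M + + 5) * ((+ 1 + M) * (+ 2 + M) + + 2) + (M + 1ℤ) * (+ 1 * + 2 * y₀ - + 4)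
    ≡⟨ cong (λ u → (M + + 4) * ((+ 2 + M) * (+ 3 + M)) - (+ 2 * M + + 5) * ((+ 1 + M) * (+ 2 + M) + + 2) + (M + 1ℤ) * (u - + 4)) h₀ ⟩
  (M + + 4) * ((+ 2 + M) * (+ 3 + M)) - (+ 2 * M + + 5) * ((+ 1 + M) * (+ 2 + M) + + 2) + (M + 1ℤ) * (M * (+ 1 + M) - + 4)
    ≡⟨ solve (M ∷ []) ⟩
  0ℤ ∎

-- The columns i = 0, 1 are separate: the general case needs the base column i − 2.
littleCoeff-recurrence : ∀ m i →
  (+ m + + 4) * littleCoeff (suc (suc m)) i - (+ 2 * + m + + 5) * (littleCoeff (suc m) i + shift (littleCoeff (suc m)) i)
    + (+ m + 1ℤ) * (littleCoeff m i - + 2 * shift (littleCoeff m) i + shift (shift (littleCoeff m)) i) ≡ 0ℤ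
littleCoeff-recurrence m zero =
  base (+ m) _ _ _ (littleCoeff-zero (suc (suc m))) (littleCoeff-zero (suc m)) (littleCoeff-zero m)
  where base : ∀ M u₂ u₁ u₀ → u₂ ≡ 1ℤ → u₁ ≡ 1ℤ → u₀ ≡ 1ℤ →
               (M + + 4) * u₂ - (+ 2 * M + + 5) * (u₁ + 0ℤ) + (M + 1ℤ) * (u₀ - + 2 * 0ℤ + 0ℤ) ≡ 0ℤ
        base M _ _ _ refl refl refl = solve (M ∷ [])
littleCoeff-recurrence m (suc zero) =
  *-zero-cancelˡ 1 (littleCoeff-recurrence-one-algebra (+ m) (littleCoeff m 1) (littleCoeff (suc m) 1) (littleCoeff (suc (suc m)) 1)
    (littleCoeff m 0) (littleCoeff (suc m) 0) (littleCoeff-zero m) (littleCoeff-zero (suc m))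
    (littleCoeff-one (suc (suc m))) (littleCoeff-one (suc m)) (littleCoeff-one m))
littleCoeff-recurrence m (suc (suc l)) =
  *-zero-cancelˡ (suc (suc l)) (*-zero-cancelˡ (suc l) (*-zero-cancelˡ (suc l) (*-zero-cancelˡ l
    (*-zero-cancelˡ (suc (suc m)) (*-zero-cancelˡ (suc m) (*-zero-cancelˡ (suc m) (*-zero-cancelˡ m
      (littleCoeff-recurrence-algebra (+ m) (+ l) (ν (suc (suc m)) l) (ν (suc m) l)
        (ν m l) (ν m (suc l)) (ν m (suc (suc l))) (ν (suc m) (suc l)) (ν (suc m) (suc (suc l)))
        (ν (suc (suc m)) (suc l)) (ν (suc (suc m)) (suc (suc l)))
        (ratio (littleCoeff-shiftⁱ (suc (suc m)) l)) (ratio (littleCoeff-shiftⁱ (suc (suc m)) (suc l)))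
        (ratio (littleCoeff-shiftⁱ (suc m) l))       (ratio (littleCoeff-shiftⁱ (suc m) (suc l)))
        (ratio (littleCoeff-shiftⁱ m l))             (ratio (littleCoeff-shiftⁱ m (suc l)))
        (ratio (littleCoeff-shiftᵐ (suc m) l))       (ratio (littleCoeff-shiftᵐ m l))))))))))
  where
  ν : ℕ → ℕ → ℤ
  ν = littleCoeff

littleCoeff-vanishes : ∀ m i → m ℕ.< i → littleCoeff m i ≡ 0ℤ
littleCoeff-vanishes m i m<i rewrite k>n⇒nCk≡0 (ℕ.s<s m<i) = refl

module _ (z : ℤ) where

  basis : ℕ → ℕ → ℤ
  basis d i = z ^ i * (z + + 1) ^ (d ℕ.∸ i)

  littleSchroder-basis : ∀ m → littleSchroder (suc m) z ≡ weighted (suc m) (littleCoeff m) (basis m)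
  littleSchroder-basis m = sumBelow-cong (suc m) (λ i → *-assoc (littleCoeff m i) (z ^ i) _)

  basis-raise : ∀ d i → i ℕ.≤ d → (z + + 1) * basis d i ≡ basis (suc d) i
  basis-raise d i i≤d = begin
    (z + + 1) * (z ^ i * (z + + 1) ^ (d ℕ.∸ i)) ≡⟨ exchange (z + + 1) (z ^ i) _ ⟩
    z ^ i * (z + + 1) ^ suc (d ℕ.∸ i)           ≡⟨ cong (λ e → z ^ i * (z + + 1) ^ e) (ℕ.+-∸-assoc 1 i≤d) ⟨
    z ^ i * (z + + 1) ^ (suc d ℕ.∸ i)           ∎
    where exchange : ∀ a b c → a * (b * c) ≡ b * (a * c)
          exchange = solve-∀

  basis-shift : ∀ d i → z * basis d i ≡ basis (suc d) (suc i)
  basis-shift d i = sym (*-assoc z (z ^ i) _)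

  weighted-raise : ∀ N d a → N ℕ.≤ suc d → (z + + 1) * weighted N a (basis d) ≡ weighted N a (basis (suc d))
  weighted-raise N d a N≤1+d = trans (weighted-*ʷ N a (basis d) (z + + 1))
    (sumBelow-cong< N (λ i i<N → cong (a i *_) (basis-raise d i (ℕ.≤-pred (ℕ.≤-trans i<N N≤1+d)))))

  weighted-shiftᶻ : ∀ N d a → z * weighted N a (basis d) ≡ weighted (suc N) (shift a) (basis (suc d))
  weighted-shiftᶻ N d a = trans (weighted-*ʷ N a (basis d) z)
    (trans (sumBelow-cong N (λ i → cong (a i *_) (basis-shift d i))) (sym (weighted-shift N a (basis (suc d)))))

-- Multiplying by z shifts the coefficients and multiplying by z + 1 raises d in the basis
-- zⁱ (z+1)^{d−i}; with 1 + 2z = (z+1) + z and 1 = ((z+1) − z)², the recurrence for s_{m+1},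
-- s_{m+2}, s_{m+3} becomes littleCoeff-recurrence in the common basis d = m + 2.
littleSchroder-recurrence : SchröderRecurrence littleSchroder
littleSchroder-recurrence zero    z = base z (littleCoeff 0 0) (littleCoeff 1 0) (littleCoeff 1 1) refl refl refl
  where
  base : ∀ z a b c → a ≡ 1ℤ → b ≡ 1ℤ → c ≡ 1ℤ →
         (+ 0 + + 3) * (0ℤ + b * 1ℤ * ((z + + 1) * 1ℤ) + c * (z * 1ℤ) * 1ℤ)
           - (+ 2 * + 0 + + 3) * (1ℤ + + 2 * z) * (0ℤ + a * 1ℤ * 1ℤ) + + 0 * 0ℤ ≡ 0ℤ
  base z _ _ _ refl refl refl = solve (z ∷ [])
littleSchroder-recurrence (suc m) z =
  combine (+ m) S₂ S₁ S₀ (W ν₂) (W ν₁) (W (shift ν₁)) (W ν₀) (W (shift ν₀)) (W (shift (shift ν₀)))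
    (littleSchroder-basis z (suc (suc m))) uS₁≡ zS₁≡ uuS₀≡ zuS₀≡ zzS₀≡
    (trans (sym (weighted-lincomb N (basis z D) terms)) (sumBelow-zero N pointwise))
  where
  N D : ℕ
  N = suc (suc (suc m))
  D = suc (suc m)
  u : ℤ
  u = z + + 1
  W : (ℕ → ℤ) → ℤ
  W a = weighted N a (basis z D)
  ν₀ ν₁ ν₂ : ℕ → ℤ
  ν₀ = littleCoeff m
  ν₁ = littleCoeff (suc m)
  ν₂ = littleCoeff (suc (suc m))
  S₀ S₁ S₂ : ℤ
  S₀ = littleSchroder (suc m) z
  S₁ = littleSchroder (suc (suc m)) z
  S₂ = littleSchroder (suc (suc (suc m))) z
  terms : LinComb
  terms = (+ m + + 4 , ν₂) ∷ (- (+ 2 * + m + + 5) , ν₁) ∷ (- (+ 2 * + m + + 5) , shift ν₁)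
        ∷ (+ m + 1ℤ , ν₀) ∷ (- (+ 2 * (+ m + 1ℤ)) , shift ν₀) ∷ (+ m + 1ℤ , shift (shift ν₀)) ∷ []
  pointwise : ∀ i → lincomb terms (λ a → a i) * basis z D i ≡ 0ℤ
  pointwise i = trans (cong (_* basis z D i) (trans (regroup (+ m) (ν₂ i) (ν₁ i) (shift ν₁ i) (ν₀ i) (shift ν₀ i) (shift (shift ν₀) i))
                                                    (littleCoeff-recurrence m i)))
                      (*-zeroˡ (basis z D i))
    where regroup : ∀ M a b b′ c c′ c″ →
            (M + + 4) * a + (- (+ 2 * M + + 5) * b + (- (+ 2 * M + + 5) * b′ + ((M + 1ℤ) * c + (- (+ 2 * (M + 1ℤ)) * c′ + ((M + 1ℤ) * c″ + 0ℤ)))))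
              ≡ (M + + 4) * a - (+ 2 * M + + 5) * (b + b′) + (M + 1ℤ) * (c - + 2 * c′ + c″)
          regroup = solve-∀
  uS₁≡ : u * S₁ ≡ W ν₁
  uS₁≡ = trans (cong (u *_) (littleSchroder-basis z (suc m)))
    (trans (weighted-raise z (suc (suc m)) (suc m) ν₁ ℕ.≤-refl)
           (sym (weighted-extend (suc (suc m)) ν₁ (basis z D) (littleCoeff-vanishes (suc m) (suc (suc m)) ℕ.≤-refl))))
  zS₁≡ : z * S₁ ≡ W (shift ν₁)
  zS₁≡ = trans (cong (z *_) (littleSchroder-basis z (suc m))) (weighted-shiftᶻ z (suc (suc m)) (suc m) ν₁)
  uS₀≡ : u * S₀ ≡ weighted (suc m) ν₀ (basis z (suc m))
  uS₀≡ = trans (cong (u *_) (littleSchroder-basis z m)) (weighted-raise z (suc m) m ν₀ ℕ.≤-refl)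
  uuS₀≡ : u * (u * S₀) ≡ W ν₀
  uuS₀≡ = trans (cong (u *_) uS₀≡) (trans (weighted-raise z (suc m) (suc m) ν₀ (ℕ.n≤1+n (suc m)))
    (sym (trans (weighted-extend (suc (suc m)) ν₀ (basis z D) (littleCoeff-vanishes m (suc (suc m)) (ℕ.m<n⇒m<1+n ℕ.≤-refl)))
                (weighted-extend (suc m) ν₀ (basis z D) (littleCoeff-vanishes m (suc m) ℕ.≤-refl)))))
  zuS₀≡ : z * (u * S₀) ≡ W (shift ν₀)
  zuS₀≡ = trans (cong (z *_) uS₀≡) (trans (weighted-shiftᶻ z (suc m) (suc m) ν₀)
    (sym (weighted-extend (suc (suc m)) (shift ν₀) (basis z D) (littleCoeff-vanishes m (suc m) ℕ.≤-refl))))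
  zzS₀≡ : z * (z * S₀) ≡ W (shift (shift ν₀))
  zzS₀≡ = trans (cong (z *_) (trans (cong (z *_) (littleSchroder-basis z m)) (weighted-shiftᶻ z (suc m) m ν₀)))
                (weighted-shiftᶻ z (suc (suc m)) (suc m) (shift ν₀))
  combine : ∀ M S₂ S₁ S₀ T₂ T₁ T₁′ T₀ T₀′ T₀″ → S₂ ≡ T₂ → (z + + 1) * S₁ ≡ T₁ → z * S₁ ≡ T₁′ →
            (z + + 1) * ((z + + 1) * S₀) ≡ T₀ → z * ((z + + 1) * S₀) ≡ T₀′ → z * (z * S₀) ≡ T₀″ →
            (M + + 4) * T₂ + (- (+ 2 * M + + 5) * T₁ + (- (+ 2 * M + + 5) * T₁′
              + ((M + 1ℤ) * T₀ + (- (+ 2 * (M + 1ℤ)) * T₀′ + ((M + 1ℤ) * T₀″ + 0ℤ))))) ≡ 0ℤ →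
            (+ 1 + M + + 3) * S₂ - (+ 2 * (+ 1 + M) + + 3) * (1ℤ + + 2 * z) * S₁ + (+ 1 + M) * S₀ ≡ 0ℤ
  combine M S₂ S₁ S₀ _ _ _ _ _ _ refl refl refl refl refl refl = trans (solve (M ∷ z ∷ S₂ ∷ S₁ ∷ S₀ ∷ []))

IsSolution : ℤ → ℤ → (ℕ → ℤ) → Set
IsSolution ε z F = ∀ k → a2 ε z (+ k) * F (suc (suc k)) + a1 ε z (+ k) * F (suc k) + a0 ε z (+ k) * F k ≡ 0ℤ

module _ (ε z : ℤ) (x : ℤ → ℤ) (F : ℕ → ℤ) where

  boundary : ℕ → ℤ
  boundary m = a0 ε z (+ m) * x (+ m) * F m - a2 ε z (+ m - + 1) * x (+ m - + 1) * F (suc m)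

  sum-adjoint : IsSolution ε z F → x -1ℤ ≡ 0ℤ → x (- + 2) ≡ 0ℤ →
                ∀ m → sumBelow (suc m) (λ k → Ladj ε z x (+ k) * F k) ≡ boundary m
  sum-adjoint LF≡0 x₋₁≡0 x₋₂≡0 zero
    rewrite x₋₁≡0 | x₋₂≡0 = base (a0 ε z 0ℤ) (x 0ℤ) (a1 ε z -1ℤ) (a2 ε z (- + 2)) (a2 ε z -1ℤ) (F 0) (F 1)
    where base : ∀ a x b c d F₀ F₁ → 0ℤ + (a * x + b * 0ℤ + c * 0ℤ) * F₀ ≡ a * x * F₀ - d * 0ℤ * F₁
          base = solve-∀
  sum-adjoint LF≡0 x₋₁≡0 x₋₂≡0 (suc m) = begin
    sumBelow (suc m) term + term (suc m)
      ≡⟨ cong₂ _+_ (sum-adjoint LF≡0 x₋₁≡0 x₋₂≡0 m) term-suc ⟩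
    boundary m + (A₀′ * X′ + A₁ * X + A₂₋ * X₋) * F (suc m)
      ≡⟨ telescope A₀ A₀′ A₁ A₂ A₂₋ X′ X X₋ (F m) (F (suc m)) (F (suc (suc m))) ⟩
    A₀′ * X′ * F (suc m) - A₂ * X * F (suc (suc m)) + X * (A₂ * F (suc (suc m)) + A₁ * F (suc m) + A₀ * F m)
      ≡⟨ cong (λ t → A₀′ * X′ * F (suc m) - A₂ * X * F (suc (suc m)) + X * t) (LF≡0 m) ⟩
    A₀′ * X′ * F (suc m) - A₂ * X * F (suc (suc m)) + X * 0ℤ
      ≡⟨ drop-zero _ X ⟩
    A₀′ * X′ * F (suc m) - A₂ * X * F (suc (suc m))
      ≡⟨ cong (λ i → A₀′ * X′ * F (suc m) - a2 ε z i * x i * F (suc (suc m))) (sym (pred-suc (+ m))) ⟩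
    boundary (suc m) ∎
    where
    term : ℕ → ℤ
    term k = Ladj ε z x (+ k) * F k
    A₀ A₀′ A₁ A₂ A₂₋ X′ X X₋ : ℤ
    A₀ = a0 ε z (+ m)
    A₀′ = a0 ε z (+ suc m)
    A₁ = a1 ε z (+ m)
    A₂ = a2 ε z (+ m)
    A₂₋ = a2 ε z (+ m - + 1)
    X′ = x (+ suc m)
    X = x (+ m)
    X₋ = x (+ m - + 1)
    pred-suc : ∀ M → + 1 + M - + 1 ≡ M
    pred-suc = solve-∀
    pred₂-suc : ∀ M → + 1 + M - + 2 ≡ M - + 1
    pred₂-suc = solve-∀
    term-suc : term (suc m) ≡ (A₀′ * X′ + A₁ * X + A₂₋ * X₋) * F (suc m)
    term-suc = cong₂ (λ i j → (A₀′ * X′ + a1 ε z i * x i + a2 ε z j * x j) * F (suc m)) (pred-suc (+ m)) (pred₂-suc (+ m))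
    telescope : ∀ A₀ A₀′ A₁ A₂ A₂₋ X′ X X₋ F₀ F₁ F₂ →
      A₀ * X * F₀ - A₂₋ * X₋ * F₁ + (A₀′ * X′ + A₁ * X + A₂₋ * X₋) * F₁
        ≡ A₀′ * X′ * F₁ - A₂ * X * F₂ + X * (A₂ * F₂ + A₁ * F₁ + A₀ * F₀)
    telescope = solve-∀
    drop-zero : ∀ a X → a + X * 0ℤ ≡ a
    drop-zero = solve-∀

sign-twisted-solution : ∀ ε z (P : ℕ → ℤ → ℤ) → ε * ε ≡ 1ℤ → SchröderRecurrence P → IsSolution ε z (λ k → ε ^ k * P k z)
sign-twisted-solution ε z P ε²≡1 rec k = core ε (ε ^ k) (+ k) z (P k z) (P (suc k) z) (P (suc (suc k)) z) ε²≡1 (rec k z)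
  where
  core : ∀ ε e K z P₀ P₁ P₂ → ε * ε ≡ 1ℤ → (K + + 3) * P₂ - (+ 2 * K + + 3) * (1ℤ + + 2 * z) * P₁ + K * P₀ ≡ 0ℤ →
         (K + + 3) * (ε * (ε * e) * P₂) + - (ε * ((+ 2 * K + + 3) * (+ 1 + + 2 * z))) * (ε * e * P₁) + K * (e * P₀) ≡ 0ℤ
  core ε e K z P₀ P₁ P₂ ε²≡1 recurrence = begin
    (K + + 3) * (ε * (ε * e) * P₂) + - (ε * ((+ 2 * K + + 3) * (+ 1 + + 2 * z))) * (ε * e * P₁) + K * (e * P₀)
      ≡⟨ solve (ε ∷ e ∷ K ∷ z ∷ P₀ ∷ P₁ ∷ P₂ ∷ []) ⟩
    e * ((ε * ε) * ((K + + 3) * P₂ - (+ 2 * K + + 3) * (1ℤ + + 2 * z) * P₁) + K * P₀)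
      ≡⟨ cong (λ t → e * (t * ((K + + 3) * P₂ - (+ 2 * K + + 3) * (1ℤ + + 2 * z) * P₁) + K * P₀)) ε²≡1 ⟩
    e * (1ℤ * ((K + + 3) * P₂ - (+ 2 * K + + 3) * (1ℤ + + 2 * z) * P₁) + K * P₀)
      ≡⟨ solve (e ∷ K ∷ z ∷ P₀ ∷ P₁ ∷ P₂ ∷ []) ⟩
    e * ((K + + 3) * P₂ - (+ 2 * K + + 3) * (1ℤ + + 2 * z) * P₁ + K * P₀)
      ≡⟨ cong (e *_) recurrence ⟩
    e * 0ℤ
      ≡⟨ *-zeroʳ e ⟩
    0ℤ ∎

boundary-factor : ∀ ε z (y : List ℤ) (F : ℕ → ℤ) m →
  boundary ε z (λ j → evalPoly y j * (j + + 1) * (j + + 2)) F m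
    ≡ + suc m * (+ suc m * + suc m - 1ℤ) * (evalPoly y (+ m) * F m - evalPoly y (+ m - + 1) * F (suc m))
boundary-factor ε z y F m = factor (+ m) (evalPoly y (+ m)) (evalPoly y (+ m - + 1)) (F m) (F (suc m))
  where
  factor : ∀ M Y₀ Y₁ F₀ F₁ →
    M * (Y₀ * (M + + 1) * (M + + 2)) * F₀ - (M - + 1 + + 3) * (Y₁ * (M - + 1 + + 1) * (M - + 1 + + 2)) * F₁
      ≡ (+ 1 + M) * ((+ 1 + M) * (+ 1 + M) - 1ℤ) * (Y₀ * F₀ - Y₁ * F₁)
  factor = solve-∀

square-of-sign : ∀ ε → ε ≡ 1ℤ ⊎ ε ≡ -1ℤ → ε * ε ≡ 1ℤ
square-of-sign _ (inj₁ refl) = refl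
square-of-sign _ (inj₂ refl) = refl

schröder-recurrence : ∀ P → P ≡ largeSchroder ⊎ P ≡ littleSchroder → SchröderRecurrence P
schröder-recurrence _ (inj₁ refl) = largeSchroder-recurrence
schröder-recurrence _ (inj₂ refl) = littleSchroder-recurrence

lemma3p2 : (ε : ℤ) → (ε ≡ 1ℤ ⊎ ε ≡ -1ℤ) →
    (P : ℕ → ℤ → ℤ) → (P ≡ largeSchroder ⊎ P ≡ littleSchroder) →
    (n : ℕ) → 2 ≤ n → (z : ℤ) → (y : List ℤ) →
    (+ n * (+ n * + n - 1ℤ)) ∣
      sumBelow n (λ k →
        Ladj ε z (λ j → evalPoly y j * (j + + 1) * (j + + 2)) (+ k)
          * ((ε ^ k) * P k z))
-- 2 ≤ n is used only to dismiss n = 0; the argument below also covers n = 1.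
lemma3p2 ε ε=±1 P P=S zero    () z y
lemma3p2 ε ε=±1 P P=S (suc m) _  z y =
  subst (divisor ∣_) (sym (trans (sum-adjoint ε z x F F-solution x₋₁≡0 x₋₂≡0 m) (boundary-factor ε z y F m)))
        (m∣m*n divisor (evalPoly y (+ m) * F m - evalPoly y (+ m - + 1) * F (suc m)))
  where
  divisor : ℤ
  divisor = + suc m * (+ suc m * + suc m - 1ℤ)
  x : ℤ → ℤ
  x j = evalPoly y j * (j + + 1) * (j + + 2)
  F : ℕ → ℤ
  F k = ε ^ k * P k z
  x₋₁≡0 : x -1ℤ ≡ 0ℤ
  x₋₁≡0 = cong (_* (-1ℤ + + 2)) (*-zeroʳ (evalPoly y -1ℤ))
  x₋₂≡0 : x (- + 2) ≡ 0ℤ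
  x₋₂≡0 = *-zeroʳ (evalPoly y (- + 2) * (- + 2 + + 1))
  F-solution : IsSolution ε z F
  F-solution = sign-twisted-solution ε z P (square-of-sign ε ε=±1) (schröder-recurrence P P=S)
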